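{- Let $G$ be a graph with $e > 0$ edges, where $3 \mid e$. Suppose there exist $G$ designs of order $e+1$, $2e+1$ and $4e+1$, and suppose there exists a decomposition into $G$ of the complete tripartite graph $K_{e/3,e/3,e/3}$. Then there exists a $G$ design of order $n$ for every $n \equiv 1 \pmod{e}$.
   Context: All graphs are simple. A decomposition of a graph $K$ into $G$ is a partition of the edge set of $K$ into edge sets of subgraphs each isomorphic to $G$; a $G$ design of order $n$ is a decomposition of the complete graph $K_n$ into $G$. By convention the empty set is a $G$ design of order $1$. -}

module Defs where

open import Data.Nat using (ℕ; zero; suc; _+_; _*_; _<_; _>_; _<?_; _≟_; NonZero)
open import Data.Nat.DivMod using (_%_; _/_)
open import Data.Bool using (Bool; true; false; not; _∧_)
open import Data.Fin using (Fin; toℕ)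
open import Data.Fin.Properties using () renaming (_≟_ to _≟ᶠ_)
open import Data.List using (List; length; filter; cartesianProduct; allFin; lookup)
open import Data.Product using (Σ; _×_; _,_; proj₁; proj₂; ∃; ∃-syntax)
open import Data.Product.Relation.Binary.Pointwise.NonDependent using ()
open import Relation.Binary.PropositionalEquality using (_≡_; refl; sym)
open import Relation.Binary.Definitions using (DecidableEquality)
open import Relation.Nullary using (yes; no)
open import Relation.Nullary.Negation using (contradiction)
open import Relation.Nullary using (¬_; does)
open import Relation.Nullary.Decidable using (_×-dec_)
open import Function.Definitions using (Injective)

record Graph : Set where
  field
    V      : ℕ
    adj    : Fin V → Fin V → Bool
    adj-sym : ∀ u v → adj u v ≡ adj v u
    irrefl : ∀ u → adj u u ≡ false
open Graph public

numEdges : Graph → ℕ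
numEdges G = length (filter (λ p → (toℕ (proj₁ p) <? toℕ (proj₂ p)) ×-dec (adj G (proj₁ p) (proj₂ p) Data.Bool.≟ true))
                            (cartesianProduct (allFin (V G)) (allFin (V G))))

-- A copy of G in K: a subgraph of K isomorphic to G, given by an injective
-- vertex map f under which every edge of G goes to an edge of K.
-- (The subgraph is the image: vertices f(V G), edges {f u , f v} for uv ∈ E G.)
record Copy (K G : Graph) : Set where
  field
    f     : Fin (V G) → Fin (V K)
    inj   : Injective _≡_ _≡_ f
    edges : ∀ u v → adj G u v ≡ true → adj K (f u) (f v) ≡ true
open Copy public

Covers : ∀ {K G} → Copy K G → Fin (V K) → Fin (V K) → Set
Covers {K} {G} c x y = ∃[ u ] ∃[ v ] (adj G u v ≡ true × f c u ≡ x × f c v ≡ y)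

Decomposition : Graph → Graph → Set
Decomposition K G =
  Σ (List (Copy K G)) λ L →
    ∀ x y → adj K x y ≡ true →
      Σ (Fin (length L)) λ k →
        Covers (lookup L k) x y × (∀ k′ → Covers (lookup L k′) x y → k′ ≡ k)

neq : ∀ {A : Set} → DecidableEquality A → A → A → Bool
neq _≟_ a b = not (does (a ≟ b))

neq-sym : ∀ {A : Set} (d : DecidableEquality A) a b → neq d a b ≡ neq d b a
neq-sym d a b with d a b | d b a
... | yes _ | yes _ = refl
... | no _  | no _  = refl
... | yes p | no ¬q = contradiction (sym p) ¬q
... | no ¬p | yes q = contradiction (sym q) ¬p

neq-irrefl : ∀ {A : Set} (d : DecidableEquality A) a → neq d a a ≡ false
neq-irrefl d a with d a a
... | yes _ = refl
... | no ¬p = contradiction refl ¬p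

K : ℕ → Graph
K n = record
  { V = n
  ; adj = neq _≟ᶠ_
  ; adj-sym = neq-sym _≟ᶠ_
  ; irrefl = neq-irrefl _≟ᶠ_
  }

-- Complete tripartite graph K_{m,m,m} on vertex set Fin (3 * m);
-- the three parts are the residue classes of toℕ i modulo 3
-- (each of size exactly m), and i ~ j iff they lie in different parts.
part : ∀ {n} → Fin n → ℕ
part i = toℕ i % 3

K3 : ℕ → Graph
K3 m = record
  { V = 3 * m
  ; adj = λ i j → neq _≟_ (part i) (part j)
  ; adj-sym = λ i j → neq-sym _≟_ (part i) (part j)
  ; irrefl = λ i → neq-irrefl _≟_ (part i)
  }

Design : Graph → ℕ → Set
Design G n = Decomposition (K n) G

-- Write e = 3m and take the points of a design of order t·e + 1 to be ∞ together with T × ℤ₃ × ℤₘ,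
-- |T| = t, where T carries a commutative quasigroup with holes of size v.  The edges inside a hole,
-- together with ∞, form a K_{v·e + 1}; every other edge lies in exactly one triangle
-- {(p , x), (q , x), (p ∙ q , x + 1)} with p, q in different holes, and a triangle blown up by ℤₘ is a
-- copy of K_{m,m,m}.  So designs of order v·e + 1 and a decomposition of K_{m,m,m} give a design of
-- order t·e + 1.  Suitable quasigroups exist for t odd with v = 1 (p ∙ q = (p + q)/2 in ℤₜ), for
-- t = 2·odd and t = 4·odd with v = 2 and v = 4 (products with ℤ₂ and ℤ₄), and for t = 8k with four
-- holes of size 2k (an explicit quasigroup of order 8 times ℤₖ).  As every t is 0, odd, 2·odd, 4·odd or
-- 8k with 2k < t, induction on t gives all orders t·e + 1 from e + 1, 2e + 1 and 4e + 1.
module Submission where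

open import Defs
open import Data.Bool using (true)
open import Data.Empty using (⊥; ⊥-elim)
open import Data.Fin as Fin using (Fin; zero; suc; toℕ; cast; combine; remQuot; #_)
open import Data.Fin.Properties
  using ( +↔⊎; *↔×; 1↔⊤; cast-involutive; toℕ-cast; toℕ-combine; combine-remQuot; remQuot-combine
        ; toℕ<n; toℕ-injective; toℕ-fromℕ<; all?; <-cmp; <-irrelevant; <-asym; <⇒≢; _<?_ )
  renaming (_≟_ to _≟ᶠ_)
open import Data.List using (List; length; lookup; tabulate)
open import Data.List.Properties using (length-tabulate; lookup-tabulate)
open import Data.Maybe using (Maybe; just; nothing)
import Data.Maybe as Maybe
open import Data.Maybe.Properties using (just-injective)
import Data.Nat as ℕ
open import Data.Nat using (ℕ; _+_; _*_; _∸_; _<_; NonZero; >-nonZero; s≤s; z≤n)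
open import Data.Nat.DivMod
  using ( _%_; _/_; _mod_; m%n<n; m≡m%n+[m/n]*n; m*[n/m]≡n; %-remove-+ˡ; m<n⇒m%n≡m; %-distribˡ-+
        ; %-distribˡ-*; m%n%n≡m%n; [m+n]%n≡m%n; [m+kn]%n≡m%n )
open import Data.Nat.Divisibility using (_∣_; m∣m*n; ∣⇒≤)
open import Data.Nat.Induction using (<-rec)
open import Data.Nat.Properties
  using (≤-trans; +-comm; +-assoc; *-comm; *-assoc; *-identityˡ; *-identityʳ; m+[n∸m]≡n; <⇒≤; m<m*n)
open import Data.Nat.Tactic.RingSolver using (solve-∀)
open import Data.Product using (Σ; ∃; ∃₂; ∃!; _×_; _,_; proj₁; proj₂; uncurry)
open import Data.Product.Function.Dependent.Propositional using (Σ-↔)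
open import Data.Product.Function.NonDependent.Propositional using (_×-↔_)
open import Data.Product.Properties using (≡-dec)
open import Data.Sum using (_⊎_; inj₁; inj₂)
open import Data.Sum.Function.Propositional using (_⊎-↔_)
open import Data.Unit using (⊤; tt)
open import Data.Vec using (Vec; []; _∷_)
import Data.Vec as Vec
open import Function using (_∘_)
open import Function.Bundles using (_↔_; _⇔_; Inverse; Equivalence; Injection; mk↔ₛ′; mk⇔)
open import Function.Definitions using (Injective)
open import Function.Properties.Equivalence using () renaming (sym to ⇔-sym; trans to ⇔-trans)
open import Function.Properties.Inverse using (↔-refl; ↔-sym; ↔-trans; ↔⇒↣)
open import Function.Related.TypeIsomorphisms using (×-comm; Σ-assoc)
open import Relation.Binary.Definitions using (DecidableEquality; Symmetric; tri<; tri≈; tri>)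
open import Relation.Binary.PropositionalEquality
open import Relation.Nullary using (¬_; yes; no; Dec; Irrelevant)
open import Relation.Nullary.Decidable using (True; toWitness; map′; ¬?; _→-dec_; decidable-stable)
open import Relation.Unary using (Decidable)

open Inverse using (to; from; strictlyInverseˡ; strictlyInverseʳ)

private variable
  A B X Y : Set

Finite : Set → Set
Finite A = ∃ λ n → Fin n ↔ A

finite-Fin : ∀ n → Finite (Fin n)
finite-Fin n = n , ↔-refl

finite-⊤ : Finite ⊤
finite-⊤ = 1 , 1↔⊤

finite-⊎ : Finite A → Finite B → Finite (A ⊎ B)
finite-⊎ (m , φ) (n , ψ) = m + n , ↔-trans +↔⊎ (φ ⊎-↔ ψ)

finite-× : Finite A → Finite B → Finite (A × B)
finite-× (m , φ) (n , ψ) = m * n , ↔-trans *↔× (φ ×-↔ ψ)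

finite-Σ-Fin : ∀ n {P : Fin n → Set} → Decidable P → (∀ {i} → Irrelevant (P i)) →
               Finite (Σ (Fin n) P)
finite-Σ-Fin ℕ.zero P? irr = 0 , mk↔ₛ′ (λ ()) (λ { (() , _) }) (λ { (() , _) }) (λ ())
finite-Σ-Fin (ℕ.suc n) {P} P? irr with finite-Σ-Fin n (P? ∘ suc) irr | P? zero
... | k , φ | yes p = ℕ.suc k , mk↔ₛ′ to′ from′ to∘from from∘to
  where
  to′ : Fin (ℕ.suc k) → Σ (Fin (ℕ.suc n)) P
  to′ zero    = zero , p
  to′ (suc i) = let (j , q) = to φ i in suc j , q
  from′ : Σ (Fin (ℕ.suc n)) P → Fin (ℕ.suc k)
  from′ (zero , _)  = zero
  from′ (suc j , q) = suc (from φ (j , q))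
  to∘from : ∀ x → to′ (from′ x) ≡ x
  to∘from (zero , p′)  = cong (zero ,_) (irr p p′)
  to∘from (suc j , q) = cong (λ (j , q) → suc j , q) (strictlyInverseˡ φ (j , q))
  from∘to : ∀ i → from′ (to′ i) ≡ i
  from∘to zero    = refl
  from∘to (suc i) = cong suc (strictlyInverseʳ φ i)
... | k , φ | no ¬p = k , mk↔ₛ′ to′ from′ to∘from (strictlyInverseʳ φ)
  where
  to′ : Fin k → Σ (Fin (ℕ.suc n)) P
  to′ i = let (j , q) = to φ i in suc j , q
  from′ : Σ (Fin (ℕ.suc n)) P → Fin k
  from′ (zero , p)  = ⊥-elim (¬p p)
  from′ (suc j , q) = from φ (j , q)
  to∘from : ∀ x → to′ (from′ x) ≡ x
  to∘from (zero , p)  = ⊥-elim (¬p p)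
  to∘from (suc j , q) = cong (λ (j , q) → suc j , q) (strictlyInverseˡ φ (j , q))

finite-Σ : {P : A → Set} → Finite A → Decidable P → (∀ {a} → Irrelevant (P a)) → Finite (Σ A P)
finite-Σ (n , φ) P? irr =
  let (k , ψ) = finite-Σ-Fin n (P? ∘ to φ) irr in k , ↔-trans ψ (Σ-↔ φ ↔-refl)

cast-↔ : ∀ {m n} → m ≡ n → Fin m ↔ Fin n
cast-↔ eq = mk↔ₛ′ (cast eq) (cast (sym eq)) (cast-involutive eq (sym eq)) (cast-involutive (sym eq) eq)

suc-↔ : ∀ n → Fin (ℕ.suc n) ↔ Maybe (Fin n)
suc-↔ n = mk↔ₛ′ to′ from′ inverseˡ inverseʳ
  where
  to′ : Fin (ℕ.suc n) → Maybe (Fin n)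
  to′ zero    = nothing
  to′ (suc i) = just i
  from′ : Maybe (Fin n) → Fin (ℕ.suc n)
  from′ nothing  = zero
  from′ (just i) = suc i
  inverseˡ : ∀ y → to′ (from′ y) ≡ y
  inverseˡ nothing  = refl
  inverseˡ (just _) = refl
  inverseʳ : ∀ x → from′ (to′ x) ≡ x
  inverseʳ zero    = refl
  inverseʳ (suc _) = refl

Maybe-↔ : A ↔ B → Maybe A ↔ Maybe B
Maybe-↔ φ = mk↔ₛ′ (Maybe.map (to φ)) (Maybe.map (from φ)) inverseˡ inverseʳ
  where
  inverseˡ : ∀ y → Maybe.map (to φ) (Maybe.map (from φ) y) ≡ y
  inverseˡ nothing  = refl
  inverseˡ (just y) = cong just (strictlyInverseˡ φ y)
  inverseʳ : ∀ x → Maybe.map (from φ) (Maybe.map (to φ) x) ≡ x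
  inverseʳ nothing  = refl
  inverseʳ (just x) = cong just (strictlyInverseʳ φ x)

↔-≢ : (φ : A ↔ B) → ∀ {x y} → x ≢ y ⇔ to φ x ≢ to φ y
↔-≢ φ = mk⇔ (λ ne eq → ne (Injection.injective (↔⇒↣ φ) eq)) (λ ne eq → ne (cong (to φ) eq))

-- Decompositions of arbitrary graphs

Adj : (H : Graph) → Fin (V H) → Fin (V H) → Set
Adj H x y = adj H x y ≡ true

EdgeImage : (Y → X) → (Y → Y → Set) → X → X → Set
EdgeImage f F x x′ = ∃₂ λ y y′ → F y y′ × f y ≡ x × f y′ ≡ x′

EdgeImage-sym : {f : Y → X} {F : Y → Y → Set} → Symmetric F → ∀ {x x′} →
                EdgeImage f F x x′ → EdgeImage f F x′ x
EdgeImage-sym F-sym (y , y′ , f , eq , eq′) = y′ , y , F-sym f , eq′ , eq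

record Embedding (X : Set) (E : X → X → Set) (G : Graph) : Set where
  field
    map       : Fin (V G) → X
    injective : Injective _≡_ _≡_ map
    edge      : ∀ {u v} → Adj G u v → E (map u) (map v)
open Embedding

record Decomp (X : Set) (E : X → X → Set) (G : Graph) : Set₁ where
  field
    Index  : Set
    finite : Finite Index
    copy   : Index → Embedding X E G
    unique : ∀ {x y} → E x y → ∃! _≡_ λ i → EdgeImage (map (copy i)) (Adj G) x y
open Decomp

module _ {E : X → X → Set} {F : Y → Y → Set} {G : Graph} where

  decomp-images : Decomp Y F G → {J : Set} → Finite J → (β : J → Y → X) →
    (∀ j → Injective _≡_ _≡_ (β j)) → (∀ j {y y′} → F y y′ → E (β j y) (β j y′)) →
    (∀ {x x′} → E x x′ → ∃! _≡_ λ j → EdgeImage (β j) F x x′) →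
    Decomp X E G
  decomp-images D {J} J-finite β β-injective β-edge β-unique = record
    { Index  = J × Index D
    ; finite = finite-× J-finite (finite D)
    ; copy   = copy′
    ; unique = unique′
    }
    where
    copy′ : J × Index D → Embedding X E G
    copy′ (j , i) = record
      { map       = β j ∘ map (copy D i)
      ; injective = injective (copy D i) ∘ β-injective j
      ; edge      = β-edge j ∘ edge (copy D i)
      }
    unique′ : ∀ {x x′} → E x x′ → ∃! _≡_ λ k → EdgeImage (map (copy′ k)) (Adj G) x x′
    unique′ e with β-unique e
    ... | j , (y , y′ , f , refl , refl) , j-unique with unique D f
    ...   | i , (u , v , a , refl , refl) , i-unique = (j , i) , (u , v , a , refl , refl) , same
      where
      same : ∀ {k} → EdgeImage (map (copy′ k)) (Adj G) _ _ → (j , i) ≡ k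
      same {j′ , i′} (u′ , v′ , a′ , eu , ev) with j-unique (_ , _ , edge (copy D i′) a′ , eu , ev)
      ... | refl = cong (j ,_) (i-unique (u′ , v′ , a′ , β-injective j eu , β-injective j ev))

  transport : (φ : Y ↔ X) → (∀ {y y′} → F y y′ ⇔ E (to φ y) (to φ y′)) → Decomp Y F G → Decomp X E G
  transport φ F⇔E D = decomp-images D finite-⊤ (λ _ → to φ) (λ _ → Injection.injective (↔⇒↣ φ))
    (λ _ → Equivalence.to F⇔E) preimage
    where
    preimage : ∀ {x x′} → E x x′ → ∃! _≡_ λ _ → EdgeImage (to φ) F x x′
    preimage {x} {x′} e =
      tt , (from φ x , from φ x′ , Equivalence.from F⇔E e′ , strictlyInverseˡ φ x , strictlyInverseˡ φ x′)
         , λ _ → refl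
      where
      e′ : E (to φ (from φ x)) (to φ (from φ x′))
      e′ = subst₂ E (sym (strictlyInverseˡ φ x)) (sym (strictlyInverseˡ φ x′)) e

decomp-⊎ : {E E₁ E₂ : X → X → Set} {G : Graph} → Decomp X E₁ G → Decomp X E₂ G →
  (∀ {x y} → E x y ⇔ (E₁ x y ⊎ E₂ x y)) → (∀ {x y} → E₁ x y → ¬ E₂ x y) → Decomp X E G
decomp-⊎ {X = X} {E} {E₁} {E₂} {G} D₁ D₂ E⇔E₁⊎E₂ disjoint = record
  { Index  = Index D₁ ⊎ Index D₂
  ; finite = finite-⊎ (finite D₁) (finite D₂)
  ; copy   = copy′
  ; unique = unique′
  }
  where
  widen : ∀ {E′} → (∀ {x y} → E′ x y → E x y) → Embedding X E′ G → Embedding X E G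
  widen E′⊆E c = record { map = map c ; injective = injective c ; edge = E′⊆E ∘ edge c }
  copy′ : Index D₁ ⊎ Index D₂ → Embedding X E G
  copy′ (inj₁ i) = widen (Equivalence.from E⇔E₁⊎E₂ ∘ inj₁) (copy D₁ i)
  copy′ (inj₂ i) = widen (Equivalence.from E⇔E₁⊎E₂ ∘ inj₂) (copy D₂ i)
  unique′ : ∀ {x y} → E x y → ∃! _≡_ λ k → EdgeImage (map (copy′ k)) (Adj G) x y
  unique′ e with Equivalence.to E⇔E₁⊎E₂ e
  ... | inj₁ e₁ with unique D₁ e₁
  ...   | i , c , i-unique = inj₁ i , c , same
    where
    same : ∀ {k} → EdgeImage (map (copy′ k)) (Adj G) _ _ → inj₁ i ≡ k
    same {inj₁ i′} c′ = cong inj₁ (i-unique c′)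
    same {inj₂ i′} (u , v , a , refl , refl) = ⊥-elim (disjoint e₁ (edge (copy D₂ i′) a))
  unique′ e | inj₂ e₂ with unique D₂ e₂
  ...   | i , c , i-unique = inj₂ i , c , same
    where
    same : ∀ {k} → EdgeImage (map (copy′ k)) (Adj G) _ _ → inj₂ i ≡ k
    same {inj₁ i′} (u , v , a , refl , refl) = ⊥-elim (disjoint (edge (copy D₁ i′) a) e₂)
    same {inj₂ i′} c′ = cong inj₂ (i-unique c′)

neq≡true⇔≢ : (d : DecidableEquality A) {a b : A} → neq d a b ≡ true ⇔ a ≢ b
neq≡true⇔≢ d {a} {b} with d a b
... | yes a≡b = mk⇔ (λ ()) (λ a≢b → ⊥-elim (a≢b a≡b))
... | no a≢b  = mk⇔ (λ _ → a≢b) (λ _ → refl)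

module _ {H G : Graph} where

  fromDecomposition : Decomposition H G → Decomp (Fin (V H)) (Adj H) G
  fromDecomposition (L , cover) = record
    { Index  = Fin (length L)
    ; finite = finite-Fin (length L)
    ; copy   = embedding ∘ lookup L
    ; unique = λ a → let (k , c , k-unique) = cover _ _ a in k , c , λ c′ → sym (k-unique _ c′)
    }
    where
    embedding : Copy H G → Embedding (Fin (V H)) (Adj H) G
    embedding c = record { map = f c ; injective = inj c ; edge = edges c _ _ }

  toDecomposition : Decomp (Fin (V H)) (Adj H) G → Decomposition H G
  toDecomposition D with finite D
  ... | n , φ = L , cover
    where
    asCopy : Index D → Copy H G
    asCopy i = let c = copy D i in record { f = map c ; inj = injective c ; edges = λ _ _ → edge c }
    L : List (Copy H G)
    L = tabulate (asCopy ∘ to φ)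
    position : Fin (length L) ↔ Index D
    position = ↔-trans (cast-↔ (length-tabulate (asCopy ∘ to φ))) φ
    lookup-L : ∀ k → lookup L k ≡ asCopy (to position k)
    lookup-L k = trans (cong (lookup L) (sym (cast-involutive _ (length-tabulate (asCopy ∘ to φ)) k)))
                       (lookup-tabulate (asCopy ∘ to φ) _)
    cover : ∀ x y → Adj H x y → Σ (Fin (length L)) λ k →
            Covers (lookup L k) x y × (∀ k′ → Covers (lookup L k′) x y → k′ ≡ k)
    cover x y a with unique D a
    ... | i , c , i-unique = from position i , covers-from , λ k′ c′ →
      sym (Inverse.inverseʳ position (i-unique (covers-to k′ c′)))
      where
      covers-from : Covers (lookup L (from position i)) x y
      covers-from rewrite lookup-L (from position i) | strictlyInverseˡ position i = c
      covers-to : ∀ k → Covers (lookup L k) x y → EdgeImage (map (copy D (to position k))) (Adj G) x y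
      covers-to k c′ rewrite lookup-L k = c′

module _ {G : Graph} where

  fromDesign : ∀ {n} → Design G n → Decomp (Fin n) _≢_ G
  fromDesign = transport ↔-refl (neq≡true⇔≢ _≟ᶠ_) ∘ fromDecomposition

  toDesign : ∀ {n} → Decomp (Fin n) _≢_ G → Design G n
  toDesign = toDecomposition ∘ transport ↔-refl (⇔-sym (neq≡true⇔≢ _≟ᶠ_))

-- Fin u × Fin v with the relation Apart is the complete u-partite graph with parts of size v.
Apart : ∀ {u v} → Fin u × Fin v → Fin u × Fin v → Set
Apart p q = proj₁ p ≢ proj₁ q

tripartite-↔ : ∀ m → Fin (3 * m) ↔ (Fin 3 × Fin m)
tripartite-↔ m = ↔-trans (cast-↔ (*-comm 3 m)) (↔-trans *↔× (×-comm _ _))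

part-tripartite : ∀ m (x : Fin (3 * m)) → part x ≡ toℕ (proj₁ (to (tripartite-↔ m) x))
part-tripartite m x = begin
  toℕ x % 3               ≡⟨ cong (_% 3) (sym (toℕ-cast (*-comm 3 m) x)) ⟩
  toℕ y % 3               ≡⟨ cong (λ z → toℕ z % 3) (sym (combine-remQuot {m} 3 y)) ⟩
  toℕ (combine q r) % 3   ≡⟨ cong (_% 3) (toℕ-combine q r) ⟩
  (3 * toℕ q + toℕ r) % 3 ≡⟨ %-remove-+ˡ (toℕ r) (m∣m*n (toℕ q)) ⟩
  toℕ r % 3               ≡⟨ m<n⇒m%n≡m (toℕ<n r) ⟩
  toℕ r                   ∎
  where
  open ≡-Reasoning
  y : Fin (m * 3)
  y = cast (*-comm 3 m) x
  q : Fin m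
  q = proj₁ (remQuot {m} 3 y)
  r : Fin 3
  r = proj₂ (remQuot {m} 3 y)

fromTripartite : ∀ {m G} → Decomposition (K3 m) G → Decomp (Fin 3 × Fin m) Apart G
fromTripartite {m} = transport (tripartite-↔ m) (⇔-trans (neq≡true⇔≢ ℕ._≟_) parts) ∘ fromDecomposition
  where
  parts : ∀ {x y} → part x ≢ part y ⇔ Apart (to (tripartite-↔ m) x) (to (tripartite-↔ m) y)
  parts {x} {y} = mk⇔
    (λ ne eq → ne (trans (part-tripartite m x) (trans (cong toℕ eq) (sym (part-tripartite m y)))))
    (λ ne eq → ne (toℕ-injective (trans (sym (part-tripartite m x)) (trans eq (part-tripartite m y)))))

module Cyclic (n : ℕ) .{{_ : NonZero n}} where

  toℕ-mod : ∀ x → toℕ (x mod n) ≡ x % n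
  toℕ-mod x = toℕ-fromℕ< (m%n<n x n)

  mod-≡ : ∀ x y → x % n ≡ y % n → x mod n ≡ y mod n
  mod-≡ x y eq = toℕ-injective (trans (toℕ-mod x) (trans eq (sym (toℕ-mod y))))

  mod-toℕ : ∀ a → toℕ a mod n ≡ a
  mod-toℕ a = toℕ-injective (trans (toℕ-mod (toℕ a)) (m<n⇒m%n≡m (toℕ<n a)))

  +-modʳ : ∀ x y → (x + toℕ (y mod n)) mod n ≡ (x + y) mod n
  +-modʳ x y = mod-≡ _ _ (begin
    (x + toℕ (y mod n)) % n     ≡⟨ cong (λ z → (x + z) % n) (toℕ-mod y) ⟩
    (x + y % n) % n             ≡⟨ %-distribˡ-+ x (y % n) n ⟩
    (x % n + y % n % n) % n     ≡⟨ cong (λ z → (x % n + z) % n) (m%n%n≡m%n y n) ⟩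
    (x % n + y % n) % n         ≡⟨ %-distribˡ-+ x y n ⟨
    (x + y) % n                 ∎)
    where open ≡-Reasoning

  +-modˡ : ∀ x y → (toℕ (x mod n) + y) mod n ≡ (x + y) mod n
  +-modˡ x y = trans (cong (_mod n) (+-comm _ y)) (trans (+-modʳ y x) (cong (_mod n) (+-comm y x)))

  *-modˡ : ∀ x k → (toℕ (x mod n) * k) mod n ≡ (x * k) mod n
  *-modˡ x k = mod-≡ _ _ (begin
    (toℕ (x mod n) * k) % n     ≡⟨ cong (λ z → (z * k) % n) (toℕ-mod x) ⟩
    (x % n * k) % n             ≡⟨ %-distribˡ-* (x % n) k n ⟩
    (x % n % n * (k % n)) % n   ≡⟨ cong (λ z → (z * (k % n)) % n) (m%n%n≡m%n x n) ⟩
    (x % n * (k % n)) % n       ≡⟨ %-distribˡ-* x k n ⟨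
    (x * k) % n                 ∎)
    where open ≡-Reasoning

  infixl 6 _⊕_ _⊖_

  _⊕_ : Fin n → Fin n → Fin n
  a ⊕ b = (toℕ a + toℕ b) mod n

  _⊖_ : Fin n → Fin n → Fin n
  a ⊖ b = (toℕ a + (n ∸ toℕ b)) mod n

  ⊕-comm : ∀ a b → a ⊕ b ≡ b ⊕ a
  ⊕-comm a b = cong (_mod n) (+-comm (toℕ a) (toℕ b))

  +-cancel-∸ : ∀ (a : Fin n) x → toℕ a + x + (n ∸ toℕ a) ≡ x + n
  +-cancel-∸ a x = begin
    toℕ a + x + (n ∸ toℕ a)     ≡⟨ cong (_+ (n ∸ toℕ a)) (+-comm (toℕ a) x) ⟩
    x + toℕ a + (n ∸ toℕ a)     ≡⟨ +-assoc x (toℕ a) _ ⟩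
    x + (toℕ a + (n ∸ toℕ a))   ≡⟨ cong (x +_) (m+[n∸m]≡n (<⇒≤ (toℕ<n a))) ⟩
    x + n                       ∎
    where open ≡-Reasoning

  ⊕-⊖ : ∀ a b → a ⊕ (b ⊖ a) ≡ b
  ⊕-⊖ a b = begin
    (toℕ a + toℕ ((toℕ b + (n ∸ toℕ a)) mod n)) mod n  ≡⟨ +-modʳ (toℕ a) _ ⟩
    (toℕ a + (toℕ b + (n ∸ toℕ a))) mod n              ≡⟨ cong (_mod n) (+-assoc (toℕ a) (toℕ b) _) ⟨
    (toℕ a + toℕ b + (n ∸ toℕ a)) mod n                ≡⟨ cong (_mod n) (+-cancel-∸ a (toℕ b)) ⟩
    (toℕ b + n) mod n                                  ≡⟨ mod-≡ _ _ ([m+n]%n≡m%n (toℕ b) n) ⟩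
    toℕ b mod n                                        ≡⟨ mod-toℕ b ⟩
    b                                                  ∎
    where open ≡-Reasoning

  ⊖-⊕ : ∀ a b → (a ⊕ b) ⊖ a ≡ b
  ⊖-⊕ a b = begin
    (toℕ ((toℕ a + toℕ b) mod n) + (n ∸ toℕ a)) mod n  ≡⟨ +-modˡ (toℕ a + toℕ b) _ ⟩
    (toℕ a + toℕ b + (n ∸ toℕ a)) mod n                ≡⟨ cong (_mod n) (+-cancel-∸ a (toℕ b)) ⟩
    (toℕ b + n) mod n                                  ≡⟨ mod-≡ _ _ ([m+n]%n≡m%n (toℕ b) n) ⟩
    toℕ b mod n                                        ≡⟨ mod-toℕ b ⟩
    b                                                  ∎
    where open ≡-Reasoning

module OddCyclic (w : ℕ) where

  U : ℕ
  U = 1 + w * 2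

  open Cyclic U public

  -- Multiplication by w + 1, the inverse of 2 modulo U.
  half : Fin U → Fin U
  half a = (toℕ a * (1 + w)) mod U

  private
    doubling : ∀ w x → (x + x) * (1 + w) ≡ x + x * (1 + w * 2)
    doubling = solve-∀

    doubling′ : ∀ w x → x * (1 + w) + x * (1 + w) ≡ x + x * (1 + w * 2)
    doubling′ = solve-∀

    mod-absorb : ∀ x → (x + x * U) mod U ≡ x mod U
    mod-absorb x = mod-≡ (x + x * U) x ([m+kn]%n≡m%n x x U)

  half-⊕-self : ∀ a → half (a ⊕ a) ≡ a
  half-⊕-self a = begin
    (toℕ (a ⊕ a) * (1 + w)) mod U ≡⟨ *-modˡ (x + x) (1 + w) ⟩
    ((x + x) * (1 + w)) mod U     ≡⟨ cong (_mod U) (doubling w x) ⟩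
    (x + x * U) mod U             ≡⟨ mod-absorb x ⟩
    x mod U                       ≡⟨ mod-toℕ a ⟩
    a                             ∎
    where
    open ≡-Reasoning
    x = toℕ a

  half-⊕-half : ∀ a → half a ⊕ half a ≡ a
  half-⊕-half a = begin
    (toℕ (half a) + toℕ (half a)) mod U ≡⟨ +-modˡ (x * (1 + w)) _ ⟩
    (x * (1 + w) + toℕ (half a)) mod U  ≡⟨ +-modʳ (x * (1 + w)) _ ⟩
    (x * (1 + w) + x * (1 + w)) mod U   ≡⟨ cong (_mod U) (doubling′ w x) ⟩
    (x + x * U) mod U                   ≡⟨ mod-absorb x ⟩
    x mod U                             ≡⟨ mod-toℕ a ⟩
    a                                   ∎
    where
    open ≡-Reasoning
    x = toℕ a

  _⊙_ : Fin U → Fin U → Fin U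
  a ⊙ b = half (a ⊕ b)

  _⊘_ : Fin U → Fin U → Fin U
  a ⊘ c = (c ⊕ c) ⊖ a

  ⊙-⊘ : ∀ a c → a ⊙ (a ⊘ c) ≡ c
  ⊙-⊘ a c = trans (cong half (⊕-⊖ a (c ⊕ c))) (half-⊕-self c)

  ⊘-⊙ : ∀ a b → a ⊘ (a ⊙ b) ≡ b
  ⊘-⊙ a b = trans (cong (_⊖ a) (half-⊕-half (a ⊕ b))) (⊖-⊕ a b)

  ⊙-idem : ∀ a → a ⊙ a ≡ a
  ⊙-idem = half-⊕-self

  ⊘-idem : ∀ a → a ⊘ a ≡ a
  ⊘-idem a = ⊖-⊕ a a

-- Commutative quasigroups with holes

-- A commutative quasigroup of order u·v with u holes of size v, the holes being the fibres of proj₁.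
-- Products within a hole are irrelevant, so the axioms only constrain points in different holes.
record CommQuasigroupWithHoles (u v : ℕ) : Set where
  infixl 7 _∙_ _\\_
  field
    _∙_ _\\_ : Fin u × Fin v → Fin u × Fin v → Fin u × Fin v
    ∙-comm   : ∀ {p q} → Apart p q → p ∙ q ≡ q ∙ p
    ∙-\\     : ∀ {p r} → Apart p r → p ∙ (p \\ r) ≡ r
    \\-∙     : ∀ {p q} → Apart p q → p \\ (p ∙ q) ≡ q
    ∙-apart  : ∀ {p q} → Apart p q → Apart (p ∙ q) p
    \\-apart : ∀ {p r} → Apart p r → Apart (p \\ r) p

  ∙-apartʳ : ∀ {p q} → Apart p q → Apart (p ∙ q) q
  ∙-apartʳ {p} {q} p≢q = subst (λ z → Apart z q) (∙-comm (≢-sym p≢q)) (∙-apart (≢-sym p≢q))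

  \\-∙ʳ : ∀ {p q} → Apart p q → q \\ (p ∙ q) ≡ p
  \\-∙ʳ p≢q = trans (cong (_ \\_) (∙-comm p≢q)) (\\-∙ (≢-sym p≢q))

oddQuasigroup : ∀ w → CommQuasigroupWithHoles (1 + w * 2) 1
oddQuasigroup w = record
  { _∙_      = λ (a , _) (b , _) → a ⊙ b , zero
  ; _\\_     = λ (a , _) (c , _) → a ⊘ c , zero
  ; ∙-comm   = λ {(a , _)} {(b , _)} _ → cong (λ x → half x , zero) (⊕-comm a b)
  ; ∙-\\     = λ { {a , _} {c , zero} _ → cong (_, zero) (⊙-⊘ a c) }
  ; \\-∙     = λ { {a , _} {b , zero} _ → cong (_, zero) (⊘-⊙ a b) }
  ; ∙-apart  = λ {(a , _)} {(b , _)} a≢b ab≡a →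
      a≢b (trans (sym (⊘-idem a)) (trans (cong (a ⊘_) (sym ab≡a)) (⊘-⊙ a b)))
  ; \\-apart = λ {(a , _)} {(c , _)} a≢c ac≡a →
      a≢c (trans (sym (⊙-idem a)) (trans (cong (a ⊙_) (sym ac≡a)) (⊙-⊘ a c)))
  }
  where open OddCyclic w

withCyclicFactor : ∀ {u g} → CommQuasigroupWithHoles u g → ∀ h → CommQuasigroupWithHoles u (g * (1 + h))
withCyclicFactor {u} {g} Q h = record
  { _∙_      = pointwise _∙_ _⊕_
  ; _\\_     = pointwise _\\_ (λ s r → r ⊖ s)
  ; ∙-comm   = λ {p} {q} ne →
      cong merge (cong₂ _,_ (∙-comm ne) (⊕-comm (proj₂ (split p)) (proj₂ (split q))))
  ; ∙-\\     = λ {p} {r} ne → trans (pointwise-merge _∙_ _⊕_ p _)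
      (trans (cong merge (cong₂ _,_ (∙-\\ ne) (⊕-⊖ (proj₂ (split p)) (proj₂ (split r)))))
             (merge-split r))
  ; \\-∙     = λ {p} {q} ne → trans (pointwise-merge _\\_ (λ s r → r ⊖ s) p _)
      (trans (cong merge (cong₂ _,_ (\\-∙ ne) (⊖-⊕ (proj₂ (split p)) (proj₂ (split q)))))
             (merge-split q))
  ; ∙-apart  = ∙-apart
  ; \\-apart = \\-apart
  }
  where
  open CommQuasigroupWithHoles Q
  open Cyclic (1 + h)
  P P′ : Set
  P  = Fin u × Fin g
  P′ = Fin u × Fin (g * (1 + h))

  split : P′ → P × Fin (1 + h)
  split (a , z) = (a , proj₁ (remQuot {g} (1 + h) z)) , proj₂ (remQuot {g} (1 + h) z)

  merge : P × Fin (1 + h) → P′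
  merge ((a , i) , s) = a , combine i s

  split-merge : ∀ x → split (merge x) ≡ x
  split-merge ((a , i) , s) = cong (λ (i , s) → (a , i) , s) (remQuot-combine {g} {1 + h} i s)

  merge-split : ∀ p → merge (split p) ≡ p
  merge-split (a , z) = cong (a ,_) (combine-remQuot {g} (1 + h) z)

  pointwise : (P → P → P) → (Fin (1 + h) → Fin (1 + h) → Fin (1 + h)) → P′ → P′ → P′
  pointwise _·_ _+′_ p q =
    merge (proj₁ (split p) · proj₁ (split q) , proj₂ (split p) +′ proj₂ (split q))

  pointwise-merge : ∀ _·_ _+′_ p x → pointwise _·_ _+′_ p (merge x) ≡
                    merge (proj₁ (split p) · proj₁ x , proj₂ (split p) +′ proj₂ x)
  pointwise-merge _·_ _+′_ p x =
    cong (λ (q , t) → merge (proj₁ (split p) · q , proj₂ (split p) +′ t)) (split-merge x)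

-- The point (a , i) is numbered 2a + i, so the holes are {0, 1}, {2, 3}, {4, 5} and {6, 7}.
-- Entries for two points of the same hole are arbitrary.
∙-table₈ : Vec (Vec (Fin 8) 8) 8
∙-table₈ =
    (# 0 ∷ # 0 ∷ # 4 ∷ # 5 ∷ # 6 ∷ # 7 ∷ # 2 ∷ # 3 ∷ [])
  ∷ (# 1 ∷ # 1 ∷ # 6 ∷ # 7 ∷ # 2 ∷ # 3 ∷ # 4 ∷ # 5 ∷ [])
  ∷ (# 4 ∷ # 6 ∷ # 2 ∷ # 2 ∷ # 7 ∷ # 0 ∷ # 5 ∷ # 1 ∷ [])
  ∷ (# 5 ∷ # 7 ∷ # 3 ∷ # 3 ∷ # 1 ∷ # 6 ∷ # 0 ∷ # 4 ∷ [])
  ∷ (# 6 ∷ # 2 ∷ # 7 ∷ # 1 ∷ # 4 ∷ # 4 ∷ # 3 ∷ # 0 ∷ [])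
  ∷ (# 7 ∷ # 3 ∷ # 0 ∷ # 6 ∷ # 5 ∷ # 5 ∷ # 1 ∷ # 2 ∷ [])
  ∷ (# 2 ∷ # 4 ∷ # 5 ∷ # 0 ∷ # 3 ∷ # 1 ∷ # 6 ∷ # 6 ∷ [])
  ∷ (# 3 ∷ # 5 ∷ # 1 ∷ # 4 ∷ # 0 ∷ # 2 ∷ # 7 ∷ # 7 ∷ [])
  ∷ []

\\-table₈ : Vec (Vec (Fin 8) 8) 8
\\-table₈ =
    (# 0 ∷ # 0 ∷ # 6 ∷ # 7 ∷ # 2 ∷ # 3 ∷ # 4 ∷ # 5 ∷ [])
  ∷ (# 1 ∷ # 1 ∷ # 4 ∷ # 5 ∷ # 6 ∷ # 7 ∷ # 2 ∷ # 3 ∷ [])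
  ∷ (# 5 ∷ # 7 ∷ # 2 ∷ # 2 ∷ # 0 ∷ # 6 ∷ # 1 ∷ # 4 ∷ [])
  ∷ (# 6 ∷ # 4 ∷ # 3 ∷ # 3 ∷ # 7 ∷ # 0 ∷ # 5 ∷ # 1 ∷ [])
  ∷ (# 7 ∷ # 3 ∷ # 1 ∷ # 6 ∷ # 4 ∷ # 4 ∷ # 0 ∷ # 2 ∷ [])
  ∷ (# 2 ∷ # 6 ∷ # 7 ∷ # 1 ∷ # 5 ∷ # 5 ∷ # 3 ∷ # 0 ∷ [])
  ∷ (# 3 ∷ # 5 ∷ # 0 ∷ # 4 ∷ # 1 ∷ # 2 ∷ # 6 ∷ # 6 ∷ [])
  ∷ (# 4 ∷ # 2 ∷ # 5 ∷ # 0 ∷ # 3 ∷ # 1 ∷ # 7 ∷ # 7 ∷ [])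
  ∷ []

module _ {u v : ℕ} where

  all-points? : {R : Fin u × Fin v → Set} → (∀ p → Dec (R p)) → Dec (∀ p → R p)
  all-points? R? = map′ (λ f (a , i) → f a i) (λ f a i → f (a , i)) (all? λ a → all? λ i → R? (a , i))

  whenApart? : {R : Fin u × Fin v → Fin u × Fin v → Set} → (∀ p q → Dec (R p q)) →
               Dec (∀ p q → Apart p q → R p q)
  whenApart? R? = all-points? λ p → all-points? λ q → ¬? (proj₁ p ≟ᶠ proj₁ q) →-dec R? p q

  byDecision : {R : Fin u × Fin v → Fin u × Fin v → Set} (R? : ∀ p q → Dec (R p q)) →
               {True (whenApart? R?)} → ∀ {p q} → Apart p q → R p q
  byDecision R? {checked} {p} {q} = toWitness checked p q

quasigroup₄ₓ₂ : CommQuasigroupWithHoles 4 2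
quasigroup₄ₓ₂ = record
  { _∙_      = _∙_
  ; _\\_     = _\\_
  ; ∙-comm   = byDecision λ p q → p ∙ q ≟ q ∙ p
  ; ∙-\\     = byDecision λ p r → p ∙ (p \\ r) ≟ r
  ; \\-∙     = byDecision λ p q → p \\ (p ∙ q) ≟ q
  ; ∙-apart  = byDecision λ p q → ¬? (proj₁ (p ∙ q) ≟ᶠ proj₁ p)
  ; \\-apart = byDecision λ p r → ¬? (proj₁ (p \\ r) ≟ᶠ proj₁ p)
  }
  where
  infixl 7 _∙_ _\\_
  infix 4 _≟_
  _≟_ : DecidableEquality (Fin 4 × Fin 2)
  _≟_ = ≡-dec _≟ᶠ_ _≟ᶠ_
  lookup₈ : Vec (Vec (Fin 8) 8) 8 → Fin 4 × Fin 2 → Fin 4 × Fin 2 → Fin 4 × Fin 2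
  lookup₈ table p q = remQuot 2 (Vec.lookup (Vec.lookup table (uncurry combine p)) (uncurry combine q))
  _∙_ _\\_ : Fin 4 × Fin 2 → Fin 4 × Fin 2 → Fin 4 × Fin 2
  _∙_  = lookup₈ ∙-table₈
  _\\_ = lookup₈ \\-table₈

-- Multiplying designs

-- The point set {∞} ∪ T × ℤ₃ × ℤₘ, with ∞ = nothing.
Points : Set → ℕ → Set
Points T m = Maybe ((T × Fin 3) × Fin m)

next : Fin 3 → Fin 3
next zero             = suc zero
next (suc zero)       = suc (suc zero)
next (suc (suc zero)) = zero

data Adjacency (x y : Fin 3) : Set where
  same     : x ≡ y → Adjacency x y
  forward  : y ≡ next x → Adjacency x y
  backward : x ≡ next y → Adjacency x y

adjacency : ∀ x y → Adjacency x y
adjacency zero             zero             = same refl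
adjacency zero             (suc zero)       = forward refl
adjacency zero             (suc (suc zero)) = backward refl
adjacency (suc zero)       zero             = backward refl
adjacency (suc zero)       (suc zero)       = same refl
adjacency (suc zero)       (suc (suc zero)) = forward refl
adjacency (suc (suc zero)) zero             = forward refl
adjacency (suc (suc zero)) (suc zero)       = backward refl
adjacency (suc (suc zero)) (suc (suc zero)) = same refl

adjacency-same : ∀ x → adjacency x x ≡ same refl
adjacency-same zero             = refl
adjacency-same (suc zero)       = refl
adjacency-same (suc (suc zero)) = refl

adjacency-forward : ∀ x → adjacency x (next x) ≡ forward refl
adjacency-forward zero             = refl
adjacency-forward (suc zero)       = refl
adjacency-forward (suc (suc zero)) = refl

adjacency-backward : ∀ x → adjacency (next x) x ≡ backward refl
adjacency-backward zero             = refl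
adjacency-backward (suc zero)       = refl
adjacency-backward (suc (suc zero)) = refl

module Multiplication {u v m : ℕ} (Q : CommQuasigroupWithHoles u v) {G : Graph} where
  open CommQuasigroupWithHoles Q

  P : Set
  P = Fin u × Fin v

  Cross : Points P m → Points P m → Set
  Cross (just ((p , _) , _)) (just ((q , _) , _)) = Apart p q
  Cross _                    _                    = ⊥

  Local : Points P m → Points P m → Set
  Local w w′ = w ≢ w′ × ¬ Cross w w′

  cross? : ∀ w w′ → Dec (Cross w w′)
  cross? (just ((p , _) , _)) (just ((q , _) , _)) = ¬? (proj₁ p ≟ᶠ proj₁ q)
  cross? (just _)             nothing              = no λ ()
  cross? nothing              _                    = no λ ()

  cross⇒≢ : ∀ {w w′} → Cross w w′ → w ≢ w′
  cross⇒≢ {just _} {just _} c eq = c (cong (proj₁ ∘ proj₁ ∘ proj₁) (just-injective eq))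

  ≢⇔local⊎cross : ∀ {w w′} → w ≢ w′ ⇔ (Local w w′ ⊎ Cross w w′)
  ≢⇔local⊎cross {w} {w′} = mk⇔ split (λ { (inj₁ (ne , _)) → ne ; (inj₂ c) → cross⇒≢ c })
    where
    split : w ≢ w′ → Local w w′ ⊎ Cross w w′
    split ne with cross? w w′
    ... | yes c = inj₂ c
    ... | no ¬c = inj₁ (ne , ¬c)

  inHole : Fin u → Points (Fin v) m → Points P m
  inHole a = Maybe.map λ ((k , x) , s) → ((a , k) , x) , s

  inHole-injective : ∀ a → Injective _≡_ _≡_ (inHole a)
  inHole-injective a {nothing} {nothing} _  = refl
  inHole-injective a {just _}  {just _}  eq =
    cong (λ (((_ , k) , x) , s) → just ((k , x) , s)) (just-injective eq)

  inHole-local : ∀ a {y y′} → y ≢ y′ → Local (inHole a y) (inHole a y′)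
  inHole-local a {y} {y′} ne = ne ∘ inHole-injective a , no-cross y y′
    where
    no-cross : ∀ y y′ → ¬ Cross (inHole a y) (inHole a y′)
    no-cross (just _) (just _) c = c refl

  inHole-hole : ∀ {a} y {b k x s} → inHole a y ≡ just (((b , k) , x) , s) → b ≡ a
  inHole-hole (just _) refl = refl

  hole-unique : ∀ {w w′} → Local w w′ → ∃! _≡_ λ a → EdgeImage (inHole a) _≢_ w w′
  hole-unique {nothing} {nothing} (ne , _) = ⊥-elim (ne refl)
  hole-unique {nothing} {just (((a , k) , x) , s)} _ =
    a , (nothing , just ((k , x) , s) , (λ ()) , refl , refl) ,
    λ (_ , y′ , _ , _ , eq) → inHole-hole y′ eq
  hole-unique {just (((a , k) , x) , s)} {nothing} _ =
    a , (just ((k , x) , s) , nothing , (λ ()) , refl , refl) ,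
    λ (y , _ , _ , eq , _) → inHole-hole y eq
  hole-unique {just (((a , k) , x) , s)} {just (((b , l) , y) , t)} (ne , ¬c)
    with decidable-stable (a ≟ᶠ b) ¬c
  ... | refl = a , (just ((k , x) , s) , just ((l , y) , t) , ne ∘ cong (inHole a) , refl , refl) ,
               λ (y , _ , _ , eq , _) → inHole-hole y eq

  -- Listing the base {p , q} of a triangle in hole order makes every triangle occur once.
  Base : Set
  Base = Σ (P × P) λ (p , q) → proj₁ p Fin.< proj₁ q

  Triangle : Set
  Triangle = Fin 3 × Base

  finite-Triangle : Finite Triangle
  finite-Triangle = finite-× (finite-Fin 3)
    (finite-Σ (finite-× finite-P finite-P) (λ (p , q) → proj₁ p <? proj₁ q) <-irrelevant)
    where
    finite-P : Finite P
    finite-P = finite-× (finite-Fin u) (finite-Fin v)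

  corner : Triangle → Fin 3 → P × Fin 3
  corner (x , (p , q) , _) zero             = p , x
  corner (x , (p , q) , _) (suc zero)       = q , x
  corner (x , (p , q) , _) (suc (suc zero)) = p ∙ q , next x

  corner-apart : ∀ t {r r′} → r ≢ r′ → Apart (proj₁ (corner t r)) (proj₁ (corner t r′))
  corner-apart (x , (p , q) , p<q) {zero}             {suc zero}       _ = <⇒≢ p<q
  corner-apart (x , (p , q) , p<q) {zero}             {suc (suc zero)} _ = ≢-sym (∙-apart (<⇒≢ p<q))
  corner-apart (x , (p , q) , p<q) {suc zero}         {zero}           _ = ≢-sym (<⇒≢ p<q)
  corner-apart (x , (p , q) , p<q) {suc zero}         {suc (suc zero)} _ = ≢-sym (∙-apartʳ (<⇒≢ p<q))
  corner-apart (x , (p , q) , p<q) {suc (suc zero)}   {zero}           _ = ∙-apart (<⇒≢ p<q)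
  corner-apart (x , (p , q) , p<q) {suc (suc zero)}   {suc zero}       _ = ∙-apartʳ (<⇒≢ p<q)
  corner-apart t {zero}             {zero}           ne = ⊥-elim (ne refl)
  corner-apart t {suc zero}         {suc zero}       ne = ⊥-elim (ne refl)
  corner-apart t {suc (suc zero)}   {suc (suc zero)} ne = ⊥-elim (ne refl)

  onTriangle : Triangle → Fin 3 × Fin m → Points P m
  onTriangle t (r , s) = just (corner t r , s)

  onTriangle-injective : ∀ t → Injective _≡_ _≡_ (onTriangle t)
  onTriangle-injective t {r , s} {r′ , s′} eq = cong₂ _,_ r≡r′ (cong proj₂ eq′)
    where
    eq′ : (corner t r , s) ≡ (corner t r′ , s′)
    eq′ = just-injective eq
    r≡r′ : r ≡ r′
    r≡r′ = decidable-stable (r ≟ᶠ r′) λ r≢r′ →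
      corner-apart t r≢r′ (cong (proj₁ ∘ proj₁ ∘ proj₁) eq′)

  sort : ∀ p q → Apart p q → Base
  sort p q ne with <-cmp (proj₁ p) (proj₁ q)
  ... | tri< p<q _ _ = (p , q) , p<q
  ... | tri≈ _ eq _  = ⊥-elim (ne eq)
  ... | tri> _ _ q<p = (q , p) , q<p

  sort-ordered : ∀ {p q q′} → q′ ≡ q → (ne : Apart p q′) (p<q : proj₁ p Fin.< proj₁ q) →
                 sort p q′ ne ≡ ((p , q) , p<q)
  sort-ordered {p} {q} refl ne p<q with <-cmp (proj₁ p) (proj₁ q)
  ... | tri< p<q′ _ _ = cong ((p , q) ,_) (<-irrelevant p<q′ p<q)
  ... | tri≈ _ eq _   = ⊥-elim (ne eq)
  ... | tri> _ _ q<p  = ⊥-elim (<-asym p<q q<p)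

  sort-reversed : ∀ {p q p′} → p′ ≡ p → (ne : Apart q p′) (p<q : proj₁ p Fin.< proj₁ q) →
                  sort q p′ ne ≡ ((p , q) , p<q)
  sort-reversed {p} {q} refl ne p<q with <-cmp (proj₁ q) (proj₁ p)
  ... | tri< q<p _ _  = ⊥-elim (<-asym p<q q<p)
  ... | tri≈ _ eq _   = ⊥-elim (ne eq)
  ... | tri> _ _ p<q′ = cong ((p , q) ,_) (<-irrelevant p<q′ p<q)

  OnTriangle : Triangle → Points P m → Points P m → Set
  OnTriangle t = EdgeImage (onTriangle t) Apart

  base-on : ∀ x p q ne s s′ → OnTriangle (x , sort p q ne) (just ((p , x) , s)) (just ((q , x) , s′))
  base-on x p q ne s s′ with <-cmp (proj₁ p) (proj₁ q)
  ... | tri< _ _ _ = (zero , s) , (suc zero , s′) , (λ ()) , refl , refl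
  ... | tri≈ _ eq _ = ⊥-elim (ne eq)
  ... | tri> _ _ _ = (suc zero , s) , (zero , s′) , (λ ()) , refl , refl

  apex-on : ∀ x p q ne s s′ →
            OnTriangle (x , sort p q ne) (just ((p , x) , s)) (just ((p ∙ q , next x) , s′))
  apex-on x p q ne s s′ with <-cmp (proj₁ p) (proj₁ q)
  ... | tri< _ _ _ = (zero , s) , (suc (suc zero) , s′) , (λ ()) , refl , refl
  ... | tri≈ _ eq _ = ⊥-elim (ne eq)
  ... | tri> _ _ _ = (suc zero , s) , (suc (suc zero) , s′) , (λ ()) , refl ,
                     cong (λ z → just ((z , next x) , s′)) (∙-comm (≢-sym ne))

  -- An edge from (p , x) to (q , next x) is a side of the triangle at level x with base {p , p \\ q}.
  triangleThrough : ∀ w w′ → Cross w w′ → Triangle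
  triangleThrough (just ((p , x) , _)) (just ((q , y) , _)) ne with adjacency x y
  ... | same _     = x , sort p q ne
  ... | forward _  = x , sort p (p \\ q) (≢-sym (\\-apart ne))
  ... | backward _ = y , sort q (q \\ p) (≢-sym (\\-apart (≢-sym ne)))

  triangleThrough-on : ∀ w w′ (c : Cross w w′) → OnTriangle (triangleThrough w w′ c) w w′
  triangleThrough-on (just ((p , x) , s)) (just ((q , y) , t)) p≢q with adjacency x y
  ... | same refl     = base-on x p q p≢q s t
  ... | forward refl  = subst (λ z → OnTriangle (x , sort p (p \\ q) ne) _ (just ((z , y) , t)))
                          (∙-\\ p≢q) (apex-on x p (p \\ q) ne s t)
    where
    ne : Apart p (p \\ q)
    ne = ≢-sym (\\-apart p≢q)
  ... | backward refl = EdgeImage-sym ≢-sym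
                          (subst (λ z → OnTriangle (y , sort q (q \\ p) ne) _ (just ((z , x) , s)))
                             (∙-\\ (≢-sym p≢q)) (apex-on y q (q \\ p) ne t s))
    where
    ne : Apart q (q \\ p)
    ne = ≢-sym (\\-apart (≢-sym p≢q))

  triangleThrough-corners : ∀ t r r′ s s′ → r ≢ r′ →
    (c : Cross (onTriangle t (r , s)) (onTriangle t (r′ , s′))) →
    triangleThrough (onTriangle t (r , s)) (onTriangle t (r′ , s′)) c ≡ t
  triangleThrough-corners (x , (p , q) , p<q) zero (suc zero) _ _ _ c
    rewrite adjacency-same x = cong (x ,_) (sort-ordered refl c p<q)
  triangleThrough-corners (x , (p , q) , p<q) (suc zero) zero _ _ _ c
    rewrite adjacency-same x = cong (x ,_) (sort-reversed refl c p<q)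
  triangleThrough-corners (x , (p , q) , p<q) zero (suc (suc zero)) _ _ _ _
    rewrite adjacency-forward x = cong (x ,_) (sort-ordered (\\-∙ (<⇒≢ p<q)) _ p<q)
  triangleThrough-corners (x , (p , q) , p<q) (suc (suc zero)) zero _ _ _ _
    rewrite adjacency-backward x = cong (x ,_) (sort-ordered (\\-∙ (<⇒≢ p<q)) _ p<q)
  triangleThrough-corners (x , (p , q) , p<q) (suc zero) (suc (suc zero)) _ _ _ _
    rewrite adjacency-forward x = cong (x ,_) (sort-reversed (\\-∙ʳ (<⇒≢ p<q)) _ p<q)
  triangleThrough-corners (x , (p , q) , p<q) (suc (suc zero)) (suc zero) _ _ _ _
    rewrite adjacency-backward x = cong (x ,_) (sort-reversed (\\-∙ʳ (<⇒≢ p<q)) _ p<q)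
  triangleThrough-corners _ zero             zero             _ _ r≢r _ = ⊥-elim (r≢r refl)
  triangleThrough-corners _ (suc zero)       (suc zero)       _ _ r≢r _ = ⊥-elim (r≢r refl)
  triangleThrough-corners _ (suc (suc zero)) (suc (suc zero)) _ _ r≢r _ = ⊥-elim (r≢r refl)

  triangle-unique : ∀ {w w′} → Cross w w′ → ∃! _≡_ λ t → OnTriangle t w w′
  triangle-unique {w} {w′} c = triangleThrough w w′ c , triangleThrough-on w w′ c ,
    λ { ((r , s) , (r′ , s′) , ne , refl , refl) → triangleThrough-corners _ r r′ s s′ ne c }

  design : Decomp (Points (Fin v) m) _≢_ G → Decomp (Fin 3 × Fin m) Apart G → Decomp (Points P m) _≢_ G
  design Dv DT = decomp-⊎
    (decomp-images Dv (finite-Fin u) inHole inHole-injective inHole-local hole-unique)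
    (decomp-images DT finite-Triangle onTriangle onTriangle-injective (λ t → corner-apart t)
       triangle-unique)
    ≢⇔local⊎cross proj₂

-- Designs of every order t·e + 1

points-↔ : ∀ t m → Fin (ℕ.suc (t * (3 * m))) ↔ Points (Fin t) m
points-↔ t m = ↔-trans (suc-↔ _) (Maybe-↔ (↔-trans *↔× (↔-trans (↔-refl ×-↔ *↔×) (↔-sym Σ-assoc))))

data Parity : ℕ → Set where
  even : ∀ k → Parity (k * 2)
  odd  : ∀ k → Parity (1 + k * 2)

parity : ∀ n → Parity n
parity ℕ.zero = even 0
parity (ℕ.suc n) with parity n
... | even k = odd k
... | odd k  = even (ℕ.suc k)

DesignOver : Graph → ℕ → ℕ → Set₁
DesignOver G m t = Decomp (Points (Fin t) m) _≢_ G

module _ {G : Graph} {m : ℕ} (DT : Decomp (Fin 3 × Fin m) Apart G) where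

  empty-design : DesignOver G m 0
  empty-design = record
    { Index  = Fin 0
    ; finite = finite-Fin 0
    ; copy   = λ ()
    ; unique = λ { {nothing} {nothing} ne → ⊥-elim (ne refl)
                 ; {just ((() , _) , _)}
                 ; {_} {just ((() , _) , _)} }
    }

  multiply : ∀ {u v} → CommQuasigroupWithHoles u v → DesignOver G m v → DesignOver G m (u * v)
  multiply {u} {v} Q Dv = transport factors (↔-≢ factors) (Multiplication.design Q Dv DT)
    where
    factors : Points (Fin u × Fin v) m ↔ Points (Fin (u * v)) m
    factors = Maybe-↔ ((↔-sym *↔× ×-↔ ↔-refl) ×-↔ ↔-refl)

  designs : DesignOver G m 1 → DesignOver G m 2 → DesignOver G m 4 → ∀ t → DesignOver G m t
  designs D₁ D₂ D₄ = <-rec (DesignOver G m) step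
    where
    step : ∀ t → (∀ {s} → s < t → DesignOver G m s) → DesignOver G m t
    step t rec with parity t
    ... | odd w = subst (DesignOver G m) (*-identityʳ _) (multiply (oddQuasigroup w) D₁)
    ... | even k with parity k
    ...   | odd w = multiply (withCyclicFactor (oddQuasigroup w) 1) D₂
    ...   | even j with parity j
    ...     | odd w = subst (DesignOver G m) (sym (*-assoc (1 + w * 2) 2 2))
                        (multiply (withCyclicFactor (oddQuasigroup w) 3) D₄)
    ...     | even ℕ.zero = empty-design
    ...     | even (ℕ.suc i) = subst (DesignOver G m) (sym (eightfold i))
                                 (multiply (withCyclicFactor quasigroup₄ₓ₂ i) (rec v<t))
      where
      eightfold : ∀ i → ℕ.suc i * 2 * 2 * 2 ≡ 4 * (2 * (1 + i))
      eightfold = solve-∀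
      v : ℕ
      v = 2 * (1 + i)
      v<t : v < ℕ.suc i * 2 * 2 * 2
      v<t = subst (v <_) (trans (*-comm v 4) (sym (eightfold i))) (m<m*n v 4 (s≤s (s≤s z≤n)))

module _ {G : Graph} {m : ℕ} where

  Design⇒DesignOver : ∀ t → Design G (ℕ.suc (t * (3 * m))) → DesignOver G m t
  Design⇒DesignOver t = transport (points-↔ t m) (↔-≢ (points-↔ t m)) ∘ fromDesign

  DesignOver⇒Design : ∀ t → DesignOver G m t → Design G (ℕ.suc (t * (3 * m)))
  DesignOver⇒Design t = toDesign ∘ transport (↔-sym (points-↔ t m)) (↔-≢ (↔-sym (points-↔ t m)))

design-≡1-mod : ∀ {G} e .{{_ : NonZero e}} → 3 ∣ e →
  Design G (e + 1) → Design G (2 * e + 1) → Design G (4 * e + 1) → Decomposition (K3 (e / 3)) G →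
  ∀ n → n % e ≡ 1 % e → Design G n
design-≡1-mod {G} e 3∣e D₁ D₂ D₄ DK n n≡1 = subst (Design G) (sym n≡qe+1) (DesignOver⇒Design q Dq)
  where
  m q : ℕ
  m = e / 3
  q = n / e

  order : ∀ t → t * e + 1 ≡ ℕ.suc (t * (3 * m))
  order t = trans (+-comm (t * e) 1) (cong (λ k → ℕ.suc (t * k)) (sym (m*[n/m]≡n 3∣e)))

  n≡qe+1 : n ≡ ℕ.suc (q * (3 * m))
  n≡qe+1 = begin
    n                   ≡⟨ m≡m%n+[m/n]*n n e ⟩
    n % e + q * e       ≡⟨ cong (_+ q * e) (trans n≡1 (m<n⇒m%n≡m 1<e)) ⟩
    1 + q * e           ≡⟨ +-comm 1 (q * e) ⟩
    q * e + 1           ≡⟨ order q ⟩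
    ℕ.suc (q * (3 * m)) ∎
    where
    open ≡-Reasoning
    1<e : 1 < e
    1<e = ≤-trans (s≤s (s≤s z≤n)) (∣⇒≤ 3∣e)

  over₁ : DesignOver G m 1
  over₁ = Design⇒DesignOver 1
    (subst (Design G) (trans (cong (_+ 1) (sym (*-identityˡ e))) (order 1)) D₁)

  over₂ : DesignOver G m 2
  over₂ = Design⇒DesignOver 2 (subst (Design G) (order 2) D₂)

  over₄ : DesignOver G m 4
  over₄ = Design⇒DesignOver 4 (subst (Design G) (order 4) D₄)

  Dq : DesignOver G m q
  Dq = designs (fromTripartite DK) over₁ over₂ over₄ q

proposition3 : (G : Graph) → (pos : 0 < numEdges G) → 3 ∣ numEdges G →
    Design G (numEdges G + 1) → Design G (2 * numEdges G + 1) → Design G (4 * numEdges G + 1) →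
    Decomposition (K3 (numEdges G / 3)) G →
    (n : ℕ) → _%_ n (numEdges G) {{>-nonZero pos}} ≡ _%_ 1 (numEdges G) {{>-nonZero pos}} → Design G n
proposition3 G pos = design-≡1-mod (numEdges G) {{>-nonZero pos}}
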